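{- Let $q>1$ be an odd integer and $p=2$. For all $U\in\mathbb{N}$, $\Omega(qU)={}^q\Omega(U)+{}^1\Omega(qU-1)$ (disjoint union).
   Context: A strictly chained $(2,q)$-ary partition of $U$ is a finite sequence of distinct positive integers of the form $2^aq^b$ ($a,b\ge0$) summing to $U$, in decreasing order, each part a multiple of the next. $\Omega(U)$ is the set of such partitions of $U$; $\Omega(0)=\{()\}$, and $\Omega(x)=\emptyset$ for $x$ not a nonnegative integer. ${}^q\Omega$ multiplies every part of every partition in $\Omega$ by $q$. ${}^1\Omega$ is obtained by increasing by $1$ the binary amount of each partition (the binary amount being the sum of its parts that are powers of $2$, or $0$ if none), i.e. replacing the power-of-2 parts by the binary expansion of (binary amount $+1$). -}

module Defs where

open import Data.Nat using (ℕ; zero; suc; _+_; _*_; _^_; _<_; _≡ᵇ_; _/_; _%_)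
open import Data.Nat.Divisibility using (_∣_)
open import Data.List using (List; []; _∷_; _++_; map; filter; upTo; reverse)
open import Data.Nat.ListAction using (sum)
open import Data.Bool.ListAction using (any)
open import Data.Bool using (Bool; true; false; not; if_then_else_; T)
open import Data.Unit using (⊤)
open import Data.Product using (_×_; ∃; ∃-syntax; Σ-syntax)
open import Relation.Binary.PropositionalEquality using (_≡_)
open import Relation.Nullary.Decidable using (T?)

Is2qPart : ℕ → ℕ → Set
Is2qPart q x = ∃[ a ] ∃[ b ] (x ≡ 2 ^ a * q ^ b)

Chained : List ℕ → Set
Chained [] = ⊤
Chained (x ∷ []) = ⊤
Chained (x ∷ y ∷ r) = (y < x) × (y ∣ x) × Chained (y ∷ r)

data AllParts (q : ℕ) : List ℕ → Set where
  []  : AllParts q []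
  _∷_ : ∀ {x xs} → Is2qPart q x → AllParts q xs → AllParts q (x ∷ xs)

-- xs ∈ Ω(U): strictly chained (2,q)-ary partition of U
IsSCP : ℕ → ℕ → List ℕ → Set
IsSCP q U xs = AllParts q xs × Chained xs × (sum xs ≡ U)

isPow2 : ℕ → Bool
isPow2 x = any (λ a → x ≡ᵇ 2 ^ a) (upTo (suc x))

binAmount : List ℕ → ℕ
binAmount xs = sum (filter (λ x → T? (isPow2 x)) xs)

-- powers of 2 in the binary expansion of n, increasing order
-- (fuel f; p is the current power of 2)
bitsAsc : ℕ → ℕ → ℕ → List ℕ
bitsAsc zero n p = []
bitsAsc (suc f) n p =
  (if n % 2 ≡ᵇ 1 then p ∷ [] else []) ++ bitsAsc f (n / 2) (2 * p)

binExp : ℕ → List ℕ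
binExp n = reverse (bitsAsc n n 1)

-- the operation defining ^1Ω: replace the power-of-2 parts by the
-- binary expansion of (binary amount + 1)
incBin : List ℕ → List ℕ
incBin xs = filter (λ x → T? (not (isPow2 x))) xs ++ binExp (binAmount xs + 1)

-- xs ∈ ^qΩ(U)
InQΩ : ℕ → ℕ → List ℕ → Set
InQΩ q U xs = ∃[ ys ] (IsSCP q U ys × xs ≡ map (q *_) ys)

-- xs ∈ ^1Ω(W - 1)  (empty when W = 0, since Ω(-1) = ∅)
In1ΩPred : ℕ → ℕ → List ℕ → Set
In1ΩPred q W xs = ∃[ V ] ∃[ ys ] (suc V ≡ W × IsSCP q V ys × xs ≡ incBin ys)

module Submission where

-- Split a (2,q)-ary partition L into its binary parts (powers of 2) and its
-- q-parts (parts 2^a·q^(c+1), i.e. all the others).  In a strictly chained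
-- partition a part dividing a power of 2 is itself a power of 2, so
-- L = qParts L ++ binParts L, and binParts L is a strictly decreasing list of
-- powers of 2, hence the binary expansion of the binary amount (binary
-- expansions are unique).  Every binary part divides each q-part 2^a·q^(c+1)
-- above it, so the binary amount is < 2^(a+1): there is "room" below each
-- q-part, and room for n is exactly what makes qParts L ++ binExp n chained.
--
-- Forward: a partition of qU without binary parts is q times a partition of
-- U; otherwise lowering the binary amount B ≥ 1 to B − 1 gives a partition of
-- qU − 1 which incBin maps back.  Backward: scaling by q is harmless; raising
-- the binary amount b of a partition of qU − 1 keeps the room, since
-- q ∣ qU and q ∣ (sum of q-parts) force q ∣ b + 1 ≠ 2^(a+1).  Disjointness:
-- scaled partitions have no binary part, while incBin always produces one.

open import Defs
open import Data.Nat using (ℕ; zero; suc; _+_; _*_; _^_; _∸_; _≤_; _<_; _%_; _/_; z≤n; s≤s; NonZero; >-nonZero; _≡ᵇ_)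
open import Data.Nat.Properties
open import Data.Nat.Divisibility
open import Data.Nat.DivMod using (m*n%n≡0; m*n/n≡m; [m+kn]%n≡m%n; +-distrib-/; m<n⇒m%n≡m; m<n⇒m/n≡0; %-distribˡ-*)
open import Data.Nat.Coprimality using (Coprime; coprime-divisor)
open import Data.Nat.ListAction using (sum)
open import Data.Nat.ListAction.Properties using (sum-++; sum-↭)
open import Data.Nat.Tactic.RingSolver using (solve-∀)
open import Algebra.Properties.CommutativeSemigroup *-commutativeSemigroup using (x∙yz≈y∙xz)
open import Data.Bool using (true; false; not; T)
open import Data.List using (List; []; _∷_; _++_; map; filter; upTo; reverseAcc)
open import Data.List.Properties using (filter-++; filter-all; filter-none; filter-accept; filter-reject; ++-identityʳ)
open import Data.List.Relation.Unary.All as All using (All; []; _∷_)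
open import Data.List.Relation.Unary.All.Properties using (++⁺; ++⁻ˡ; ++⁻ʳ; all-filter; filter⁺)
open import Data.List.Relation.Unary.Any using (satisfied)
open import Data.List.Relation.Unary.Any.Properties using (any⁺; any⁻)
open import Data.List.Membership.Propositional using (lose)
open import Data.List.Membership.Propositional.Properties using (∈-upTo⁺)
open import Data.List.Relation.Binary.Permutation.Propositional.Properties using (↭-reverse)
open import Data.Unit using (tt)
open import Data.Empty using (⊥; ⊥-elim)
open import Data.Product using (_×_; _,_; proj₁; proj₂; ∃₂; ∃-syntax)
open import Data.Sum using (_⊎_; inj₁; inj₂; [_,_])
open import Function using (_∘_)
open import Function.Bundles using (_⇔_; mk⇔)
open import Relation.Nullary using (¬_; yes; no)
open import Relation.Nullary.Decidable using (T?)
open import Relation.Unary using (Decidable)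
open import Relation.Binary.PropositionalEquality using (_≡_; refl; sym; trans; cong; cong₂; subst; subst₂; module ≡-Reasoning)

-- Arithmetic of powers of 2 and of odd numbers

-- Bounds the fuel of binExp and the search range of isPow2.
n<2^n : ∀ n → n < 2 ^ n
n<2^n zero = s≤s z≤n
n<2^n (suc n) = begin-strict
  suc n           ≤⟨ +-monoˡ-≤ n (m^n>0 2 n) ⟩
  2 ^ n + n       <⟨ +-monoʳ-< (2 ^ n) (n<2^n n) ⟩
  2 ^ n + 2 ^ n   ≡⟨ cong (2 ^ n +_) (sym (+-identityʳ (2 ^ n))) ⟩
  2 ^ suc n       ∎
  where open ≤-Reasoning

2^-reflects-< : ∀ {i j} → 2 ^ i < 2 ^ j → i < j
2^-reflects-< {i} {j} lt with i <? j
... | yes i<j = i<j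
... | no i≮j = ⊥-elim (<⇒≱ lt (^-monoʳ-≤ 2 (≮⇒≥ i≮j)))

2^∣2^ : ∀ {i j} → i ≤ j → 2 ^ i ∣ 2 ^ j
2^∣2^ {i} {j} i≤j = divides (2 ^ (j ∸ i)) (begin
  2 ^ j                 ≡⟨ cong (2 ^_) (sym (m+[n∸m]≡n i≤j)) ⟩
  2 ^ (i + (j ∸ i))     ≡⟨ ^-distribˡ-+-* 2 i (j ∸ i) ⟩
  2 ^ i * 2 ^ (j ∸ i)   ≡⟨ *-comm (2 ^ i) (2 ^ (j ∸ i)) ⟩
  2 ^ (j ∸ i) * 2 ^ i   ∎)
  where open ≡-Reasoning

Odd : ℕ → Set
Odd n = n % 2 ≡ 1

odd-* : ∀ {m n} → Odd m → Odd n → Odd (m * n)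
odd-* {m} {n} om on = trans (%-distribˡ-* m n 2) (cong₂ (λ u v → (u * v) % 2) om on)

odd-^ : ∀ {m} → Odd m → ∀ c → Odd (m ^ c)
odd-^ om zero = refl
odd-^ {m} om (suc c) = odd-* {m} {m ^ c} om (odd-^ om c)

odd⇒2∤ : ∀ {n} → Odd n → ¬ 2 ∣ n
odd⇒2∤ {n} on 2∣n = 0≢1+n (trans (sym (n∣m⇒m%n≡0 n 2 2∣n)) on)

odd⇒coprime-2 : ∀ {n} → Odd n → Coprime n 2
odd⇒coprime-2 _ {zero} (_ , 0∣2) = ⊥-elim (0≢1+n (sym (0∣⇒≡0 0∣2)))
odd⇒coprime-2 _ {suc zero} _ = refl
odd⇒coprime-2 on {suc (suc zero)} (2∣n , _) = ⊥-elim (odd⇒2∤ on 2∣n)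
odd⇒coprime-2 _ {suc (suc (suc _))} (_ , d∣2) with ∣⇒≤ d∣2
... | s≤s (s≤s ())

odd∤2^ : ∀ {o} → Odd o → 1 < o → ∀ n → ¬ o ∣ 2 ^ n
odd∤2^ on 1<o zero o∣1 = <⇒≢ 1<o (sym (∣1⇒≡1 o∣1))
odd∤2^ on 1<o (suc n) o∣2^1+n =
  odd∤2^ on 1<o n (coprime-divisor (odd⇒coprime-2 on) o∣2^1+n)

2^∣2^*odd : ∀ {o} → Odd o → ∀ j a → 2 ^ j ∣ 2 ^ a * o → j ≤ a
2^∣2^*odd on zero a _ = z≤n
2^∣2^*odd {o} on (suc j) zero d =
  ⊥-elim (odd⇒2∤ on (subst (2 ∣_) (*-identityˡ o) (m*n∣⇒m∣ 2 (2 ^ j) d)))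
2^∣2^*odd {o} on (suc j) (suc a) d =
  s≤s (2^∣2^*odd on j a (*-cancelˡ-∣ 2 (subst (2 * 2 ^ j ∣_) (*-assoc 2 (2 ^ a) o) d)))

isPow2-sound : ∀ {x} → T (isPow2 x) → ∃[ j ] x ≡ 2 ^ j
isPow2-sound {x} t with satisfied (any⁻ (λ a → x ≡ᵇ 2 ^ a) (upTo (suc x)) t)
... | j , x≡ᵇ2^j = j , ≡ᵇ⇒≡ x (2 ^ j) x≡ᵇ2^j

isPow2-complete : ∀ j → T (isPow2 (2 ^ j))
isPow2-complete j = any⁺ (λ a → 2 ^ j ≡ᵇ 2 ^ a)
  (lose (∈-upTo⁺ (s≤s (<⇒≤ (n<2^n j)))) (≡⇒≡ᵇ (2 ^ j) (2 ^ j) refl))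

-- Binary expansions.  `Desc b L`: L is a strictly decreasing list of powers
-- of 2, all below 2^b.  `Asc k L`: a strictly increasing one, all ≥ 2^k.

data Desc : ℕ → List ℕ → Set where
  [] : ∀ {b} → Desc b []
  _∷_ : ∀ {b j L} → j < b → Desc j L → Desc b (2 ^ j ∷ L)

data Asc : ℕ → List ℕ → Set where
  [] : ∀ {k} → Asc k []
  _∷_ : ∀ {k j L} → k ≤ j → Asc (suc j) L → Asc k (2 ^ j ∷ L)

asc-weaken : ∀ {k k′ L} → k ≤ k′ → Asc k′ L → Asc k L
asc-weaken k≤k′ [] = []
asc-weaken k≤k′ (k′≤j ∷ A) = ≤-trans k≤k′ k′≤j ∷ A

desc-weaken : ∀ {b b′ L} → b ≤ b′ → Desc b L → Desc b′ L
desc-weaken b≤b′ [] = []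
desc-weaken b≤b′ (j<b ∷ D) = <-≤-trans j<b b≤b′ ∷ D

desc-exponents : ∀ {b L} → Desc b L → All (λ y → ∃[ i ] i < b × y ≡ 2 ^ i) L
desc-exponents [] = []
desc-exponents (_∷_ {j = j} j<b D) =
  (j , j<b , refl) ∷ All.map (λ (i , i<j , y≡2^i) → i , <-trans i<j j<b , y≡2^i) (desc-exponents D)

desc-sum< : ∀ {b L} → Desc b L → sum L < 2 ^ b
desc-sum< {b} [] = m^n>0 2 b
desc-sum< {b} (_∷_ {j = j} {L} j<b D) = begin-strict
  2 ^ j + sum L     <⟨ +-monoʳ-< (2 ^ j) (desc-sum< D) ⟩
  2 ^ j + 2 ^ j     ≡⟨ cong (2 ^ j +_) (sym (+-identityʳ (2 ^ j))) ⟩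
  2 ^ suc j         ≤⟨ ^-monoʳ-≤ 2 j<b ⟩
  2 ^ b             ∎
  where open ≤-Reasoning

desc-tighten : ∀ {b c L} → Desc b L → sum L < 2 ^ c → Desc c L
desc-tighten [] _ = []
desc-tighten (_∷_ {j = j} _ D) lt = 2^-reflects-< (≤-<-trans (m≤m+n (2 ^ j) _) lt) ∷ D

desc-top : ∀ {i j M M′} → Desc i M′ → 2 ^ j + sum M ≡ 2 ^ i + sum M′ → j ≤ i
desc-top {i} {j} {M} {M′} D′ e = ≤-pred (2^-reflects-< (begin-strict
  2 ^ j                ≤⟨ m≤m+n (2 ^ j) (sum M) ⟩
  2 ^ j + sum M        ≡⟨ e ⟩
  2 ^ i + sum M′       <⟨ desc-sum< (n<1+n i ∷ D′) ⟩
  2 ^ suc i            ∎))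
  where open ≤-Reasoning

desc-unique : ∀ {b b′ M M′} → Desc b M → Desc b′ M′ → sum M ≡ sum M′ → M ≡ M′
desc-unique [] [] _ = refl
desc-unique [] (_∷_ {j = i} _ _) e = ⊥-elim (<⇒≢ (<-≤-trans (m^n>0 2 i) (m≤m+n _ _)) e)
desc-unique (_∷_ {j = j} _ _) [] e = ⊥-elim (<⇒≢ (<-≤-trans (m^n>0 2 j) (m≤m+n _ _)) (sym e))
desc-unique (_∷_ {j = j} {M} _ T) (_∷_ {L = M′} _ T′) e
  with ≤-antisym (desc-top {M = M} T′ e) (desc-top {M = M′} T (sym e))
... | refl = cong (2 ^ j ∷_) (desc-unique T T′ (+-cancelˡ-≡ (2 ^ j) (sum M) (sum M′) e))

data Parity : ℕ → Set where
  even : ∀ m → Parity (2 * m)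
  odd  : ∀ m → Parity (suc (2 * m))

parity : ∀ n → Parity n
parity zero = even 0
parity (suc n) with parity n
... | even m = odd m
... | odd m = subst Parity (*-suc 2 m) (even (suc m))

halve : ∀ b m → b < 2 → (b + 2 * m) % 2 ≡ b × (b + 2 * m) / 2 ≡ m
halve b m b<2 rewrite *-comm 2 m =
  trans ([m+kn]%n≡m%n b m 2) (m<n⇒m%n≡m b<2) ,
  trans (+-distrib-/ b (m * 2) b%2+2m%2<2) (cong₂ _+_ (m<n⇒m/n≡0 b<2) (m*n/n≡m m 2))
  where
  b%2+2m%2<2 : b % 2 + (m * 2) % 2 < 2
  b%2+2m%2<2 = subst₂ (λ u v → u + v < 2) (sym (m<n⇒m%n≡m b<2)) (sym (m*n%n≡0 m 2))
    (subst (_< 2) (sym (+-identityʳ b)) b<2)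

bitsAsc-even : ∀ f m p → bitsAsc (suc f) (2 * m) p ≡ bitsAsc f m (2 * p)
bitsAsc-even f m p rewrite proj₁ (halve 0 m (s≤s z≤n)) | proj₂ (halve 0 m (s≤s z≤n)) = refl

bitsAsc-odd : ∀ f m p → bitsAsc (suc f) (suc (2 * m)) p ≡ p ∷ bitsAsc f m (2 * p)
bitsAsc-odd f m p rewrite proj₁ (halve 1 m ≤-refl) | proj₂ (halve 1 m ≤-refl) = refl

bitsAsc-spec : ∀ f n k → n < 2 ^ f →
  Asc k (bitsAsc f n (2 ^ k)) × sum (bitsAsc f n (2 ^ k)) ≡ 2 ^ k * n
bitsAsc-spec zero zero k _ = [] , sym (*-zeroʳ (2 ^ k))
bitsAsc-spec zero (suc n) k (s≤s ())
bitsAsc-spec (suc f) n k n<2^1+f with parity n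
... | even m rewrite bitsAsc-even f m (2 ^ k) =
  let A , S = bitsAsc-spec f m (suc k) (*-cancelˡ-< 2 m (2 ^ f) n<2^1+f)
  in asc-weaken (n≤1+n k) A , trans S (double-right (2 ^ k) m)
  where double-right : ∀ p m → 2 * p * m ≡ p * (2 * m)
        double-right = solve-∀
... | odd m rewrite bitsAsc-odd f m (2 ^ k) =
  let A , S = bitsAsc-spec f m (suc k) (*-cancelˡ-< 2 m (2 ^ f) (<⇒≤ n<2^1+f))
  in ≤-refl ∷ A , trans (cong (2 ^ k +_) S) (add-odd (2 ^ k) m)
  where add-odd : ∀ p m → p + 2 * p * m ≡ p * suc (2 * m)
        add-odd = solve-∀

asc-reverse : ∀ {k L M} → Asc k L → Desc k M → ∃[ b ] Desc b (reverseAcc M L)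
asc-reverse {k} [] D = k , D
asc-reverse (k≤j ∷ A) D = asc-reverse A (≤-refl ∷ desc-weaken k≤j D)

binExp-desc : ∀ n → ∃[ b ] Desc b (binExp n)
binExp-desc n = asc-reverse (proj₁ (bitsAsc-spec n n 0 (n<2^n n))) []

binExp-sum : ∀ n → sum (binExp n) ≡ n
binExp-sum n = trans (sum-↭ (↭-reverse (bitsAsc n n 1)))
  (trans (proj₂ (bitsAsc-spec n n 0 (n<2^n n))) (*-identityˡ n))

binExp-bounded : ∀ {n c} → n < 2 ^ c → Desc c (binExp n)
binExp-bounded {n} n<2^c =
  desc-tighten (proj₂ (binExp-desc n)) (subst (_< _) (sym (binExp-sum n)) n<2^c)

binExp-unique : ∀ {b M} → Desc b M → binExp (sum M) ≡ M
binExp-unique {M = M} D = desc-unique (proj₂ (binExp-desc (sum M))) D (binExp-sum (sum M))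

Below : ℕ → List ℕ → Set
Below x = All (λ y → y < x × y ∣ x)

chained-tail : ∀ {x L} → Chained (x ∷ L) → Chained L
chained-tail {L = []} _ = tt
chained-tail {L = _ ∷ _} (_ , _ , c) = c

chained-below : ∀ {x L} → Chained (x ∷ L) → Below x L
chained-below {L = []} _ = []
chained-below {L = y ∷ _} (y<x , y∣x , c) =
  (y<x , y∣x) ∷ All.map (λ (z<y , z∣y) → <-trans z<y y<x , ∣-trans z∣y y∣x) (chained-below c)

chained-∷ : ∀ {x L} → Chained L → Below x L → Chained (x ∷ L)
chained-∷ {L = []} _ _ = tt
chained-∷ {L = _ ∷ _} c ((y<x , y∣x) ∷ _) = y<x , y∣x , c

chained-++ : ∀ {A B} → Chained A → Chained B → All (λ x → Below x B) A → Chained (A ++ B)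
chained-++ {[]} _ cB [] = cB
chained-++ {x ∷ A} cA cB (bx ∷ bA) =
  chained-∷ (chained-++ (chained-tail cA) cB bA) (++⁺ (chained-below cA) bx)

chained-++⁻ : ∀ A {B} → Chained (A ++ B) → Chained A × Chained B × All (λ x → Below x B) A
chained-++⁻ [] c = tt , c , []
chained-++⁻ (x ∷ A) c =
  let cA , cB , bA = chained-++⁻ A (chained-tail c)
      bx = chained-below {x} {A ++ _} c
  in chained-∷ cA (++⁻ˡ A bx) , cB , ++⁻ʳ A bx ∷ bA

desc-below : ∀ {j L} → Desc j L → Below (2 ^ j) L
desc-below D = All.map (λ (i , i<j , y≡2^i) →
  subst (λ y → y < _ × y ∣ _) (sym y≡2^i) (^-monoʳ-< 2 (s≤s (s≤s z≤n)) i<j , 2^∣2^ (<⇒≤ i<j)))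
  (desc-exponents D)

desc-below-multiple : ∀ {a m L} → 1 < m → Desc (suc a) L → Below (2 ^ a * m) L
desc-below-multiple {a} {m} 1<m D = All.map (λ (i , i<1+a , y≡2^i) →
  let i≤a = ≤-pred i<1+a in
  subst (λ y → y < _ × y ∣ _) (sym y≡2^i)
    (≤-<-trans (^-monoʳ-≤ 2 i≤a) (m<m*n (2 ^ a) m {{m^n≢0 2 a}} 1<m) ,
     ∣m⇒∣m*n m (2^∣2^ i≤a)))
  (desc-exponents D)

desc-chained : ∀ {b L} → Desc b L → Chained L
desc-chained [] = tt
desc-chained (_ ∷ D) = chained-∷ (desc-chained D) (desc-below D)

desc-binary : ∀ {b L} → Desc b L → All (T ∘ isPow2) L
desc-binary D = All.map (λ (i , _ , y≡2^i) → subst (T ∘ isPow2) (sym y≡2^i) (isPow2-complete i))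
  (desc-exponents D)

powers-desc : ∀ {b L} → All (T ∘ isPow2) L → Chained L → All (_< 2 ^ b) L → Desc b L
powers-desc [] _ _ = []
powers-desc {L = x ∷ _} (px ∷ pL) c (x<2^b ∷ _) with isPow2-sound {x} px
... | j , refl = _∷_ {j = j} (2^-reflects-< x<2^b)
  (powers-desc pL (chained-tail c) (All.map proj₁ (chained-below c)))

powers-desc-∃ : ∀ {L} → All (T ∘ isPow2) L → Chained L → ∃[ b ] Desc b L
powers-desc-∃ [] _ = 0 , []
powers-desc-∃ {x ∷ _} bins@(px ∷ _) c with isPow2-sound {x} px
... | j , refl = suc j , powers-desc bins c
  (2^j<2^1+j ∷ All.map (λ (y<x , _) → <-trans y<x 2^j<2^1+j) (chained-below c))
  where 2^j<2^1+j : 2 ^ j < 2 ^ suc j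
        2^j<2^1+j = ^-monoʳ-< 2 (s≤s (s≤s z≤n)) (n<1+n j)

below-odd-multiple : ∀ {a o P} → Odd o → All (T ∘ isPow2) P → Below (2 ^ a * o) P →
  All (_< 2 ^ suc a) P
below-odd-multiple {a} on bins below = All.zipWith (λ (py , (_ , y∣2^a*o)) → bound py y∣2^a*o)
  (bins , below)
  where
  bound : ∀ {y} → T (isPow2 y) → y ∣ 2 ^ a * _ → y < 2 ^ suc a
  bound {y} py d with isPow2-sound {y} py
  ... | j , refl = ^-monoʳ-< 2 (s≤s (s≤s z≤n)) (s≤s (2^∣2^*odd on j a d))

binary? : Decidable (T ∘ isPow2)
binary? x = T? (isPow2 x)

nonBinary? : Decidable (T ∘ not ∘ isPow2)
nonBinary? x = T? (not (isPow2 x))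

binParts qParts : List ℕ → List ℕ
binParts = filter binary?
qParts = filter nonBinary?

T-not : ∀ {b} → T (not b) → ¬ T b
T-not {false} _ ()

not-T : ∀ {b} → ¬ T b → T (not b)
not-T {false} _ = tt
not-T {true} ¬t = ¬t tt

all-binary : ∀ {L} → All (T ∘ isPow2) L → qParts L ≡ [] × binParts L ≡ L
all-binary bins = filter-none nonBinary? (All.map (λ b nb → T-not nb b) bins) , filter-all binary? bins

all-nonBinary : ∀ {L} → All (T ∘ not ∘ isPow2) L → qParts L ≡ L × binParts L ≡ []
all-nonBinary nbs = filter-all nonBinary? nbs , filter-none binary? (All.map T-not nbs)

incBin-qParts : ∀ L n → qParts (qParts L ++ binExp n) ≡ qParts L
incBin-qParts L n = begin
  qParts (qParts L ++ binExp n)          ≡⟨ filter-++ nonBinary? (qParts L) (binExp n) ⟩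
  qParts (qParts L) ++ qParts (binExp n) ≡⟨ cong₂ _++_ (proj₁ (all-nonBinary (all-filter nonBinary? L)))
                                                        (proj₁ (all-binary (desc-binary (proj₂ (binExp-desc n))))) ⟩
  qParts L ++ []                         ≡⟨ ++-identityʳ (qParts L) ⟩
  qParts L                               ∎
  where open ≡-Reasoning

incBin-binParts : ∀ L n → binParts (qParts L ++ binExp n) ≡ binExp n
incBin-binParts L n = begin
  binParts (qParts L ++ binExp n)            ≡⟨ filter-++ binary? (qParts L) (binExp n) ⟩
  binParts (qParts L) ++ binParts (binExp n) ≡⟨ cong₂ _++_ (proj₂ (all-nonBinary (all-filter nonBinary? L)))
                                                            (proj₂ (all-binary (desc-binary (proj₂ (binExp-desc n))))) ⟩
  binExp n                                   ∎
  where open ≡-Reasoning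

incBin-sum : ∀ L n → sum (qParts L ++ binExp n) ≡ sum (qParts L) + n
incBin-sum L n = trans (sum-++ (qParts L) (binExp n)) (cong (sum (qParts L) +_) (binExp-sum n))

sum-scale : ∀ q ys → sum (map (q *_) ys) ≡ q * sum ys
sum-scale q [] = sym (*-zeroʳ q)
sum-scale q (y ∷ ys) = trans (cong (q * y +_) (sum-scale q ys)) (sym (*-distribˡ-+ q y (sum ys)))

chained-scale : ∀ q {{_ : NonZero q}} ys → Chained ys → Chained (map (q *_) ys)
chained-scale q [] _ = tt
chained-scale q (_ ∷ []) _ = tt
chained-scale q (y ∷ z ∷ r) (z<y , z∣y , c) = *-monoʳ-< q z<y , *-monoʳ-∣ q z∣y , chained-scale q (z ∷ r) c

chained-unscale : ∀ q {{_ : NonZero q}} ys → Chained (map (q *_) ys) → Chained ys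
chained-unscale q [] _ = tt
chained-unscale q (_ ∷ []) _ = tt
chained-unscale q (y ∷ z ∷ r) (qz<qy , qz∣qy , c) =
  *-cancelˡ-< q z y qz<qy , *-cancelˡ-∣ q qz∣qy , chained-unscale q (z ∷ r) c

parts⁻ : ∀ {q L} → AllParts q L → All (Is2qPart q) L
parts⁻ [] = []
parts⁻ (p ∷ ps) = p ∷ parts⁻ ps

parts⁺ : ∀ {q L} → All (Is2qPart q) L → AllParts q L
parts⁺ [] = []
parts⁺ (p ∷ ps) = p ∷ parts⁺ ps

desc-parts : ∀ {q b L} → Desc b L → All (Is2qPart q) L
desc-parts D = All.map (λ (i , _ , y≡2^i) → i , 0 , trans y≡2^i (sym (*-identityʳ _))) (desc-exponents D)

module OddBase (q : ℕ) (1<q : 1 < q) (q-odd : Odd q) where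

  instance
    q≢0 : NonZero q
    q≢0 = >-nonZero (<-trans (s≤s z≤n) 1<q)

  QPart : ℕ → Set
  QPart x = ∃₂ λ a c → x ≡ 2 ^ a * q ^ suc c

  q∣qPart : ∀ {x} → QPart x → q ∣ x
  q∣qPart (a , c , refl) = ∣n⇒∣m*n (2 ^ a) (m∣m*n (q ^ c))

  q∤2^ : ∀ n → ¬ q ∣ 2 ^ n
  q∤2^ = odd∤2^ q-odd 1<q

  qPart-nonBinary : ∀ {x} → QPart x → ¬ T (isPow2 x)
  qPart-nonBinary {x} qx px with isPow2-sound {x} px
  ... | j , refl = q∤2^ j (q∣qPart qx)

  qPart-part : ∀ {x} → QPart x → Is2qPart q x
  qPart-part (a , c , x≡) = a , suc c , x≡

  part-cases : ∀ {x} → Is2qPart q x → T (isPow2 x) ⊎ QPart x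
  part-cases (a , zero , refl) = inj₁ (subst (T ∘ isPow2) (sym (*-identityʳ (2 ^ a))) (isPow2-complete a))
  part-cases (a , suc c , x≡) = inj₂ (a , c , x≡)

  binary-divisor : ∀ {y j} → Is2qPart q y → y ∣ 2 ^ j → T (isPow2 y)
  binary-divisor {j = j} py y∣2^j with part-cases py
  ... | inj₁ by = by
  ... | inj₂ qy = ⊥-elim (q∤2^ j (∣-trans (q∣qPart qy) y∣2^j))

  qParts-form : ∀ {L} → All (Is2qPart q) L → All QPart (qParts L)
  qParts-form {L} ps = All.zipWith (λ (px , nbx) → qPart-of px nbx)
    (filter⁺ nonBinary? ps , all-filter nonBinary? L)
    where
    qPart-of : ∀ {x} → Is2qPart q x → T (not (isPow2 x)) → QPart x
    qPart-of px nbx with part-cases px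
    ... | inj₁ bx = ⊥-elim (T-not nbx bx)
    ... | inj₂ qx = qx

  q∣sum : ∀ {L} → All QPart L → q ∣ sum L
  q∣sum [] = q ∣0
  q∣sum (qx ∷ qs) = ∣m∣n⇒∣m+n (q∣qPart qx) (q∣sum qs)

  binary-suffix : ∀ {x L} → All (Is2qPart q) L → Chained (x ∷ L) → T (isPow2 x) →
    All (T ∘ isPow2) (x ∷ L)
  binary-suffix {x} ps c bx with isPow2-sound {x} bx
  ... | j , refl = bx ∷ All.zipWith (λ (py , (_ , y∣2^j)) → binary-divisor {j = j} py y∣2^j) (ps , chained-below c)

  chained-shape : ∀ {L} → All (Is2qPart q) L → Chained L → L ≡ qParts L ++ binParts L
  chained-shape [] _ = refl
  chained-shape {x ∷ L} (px ∷ ps) c with part-cases px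
  ... | inj₁ bx = let bins = binary-suffix ps c bx in
    sym (cong₂ _++_ (proj₁ (all-binary bins)) (proj₂ (all-binary bins)))
  ... | inj₂ qx = begin
    x ∷ L                                   ≡⟨ cong (x ∷_) (chained-shape ps (chained-tail c)) ⟩
    x ∷ qParts L ++ binParts L              ≡⟨ cong₂ _++_ (sym (filter-accept nonBinary? {x} {L} (not-T nb)))
                                                          (sym (filter-reject binary? {x} {L} nb)) ⟩
    qParts (x ∷ L) ++ binParts (x ∷ L)      ∎
    where open ≡-Reasoning
          nb : ¬ T (isPow2 x)
          nb = qPart-nonBinary qx

  shape-split : ∀ {L} → All (Is2qPart q) L → Chained L →
    Chained (qParts L) × Chained (binParts L) × All (λ x → Below x (binParts L)) (qParts L)
  shape-split {L} ps c = chained-++⁻ (qParts L) (subst Chained (chained-shape ps c) c)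

  sum-shape : ∀ {L} → All (Is2qPart q) L → Chained L → sum L ≡ sum (qParts L) + binAmount L
  sum-shape {L} ps c = trans (cong sum (chained-shape ps c)) (sum-++ (qParts L) (binParts L))

  -- `Room n x`: x is a q-part 2^a·q^(c+1) with n < 2^(a+1), i.e. the binary
  -- expansion of n fits below x.
  Room : ℕ → ℕ → Set
  Room n x = ∃₂ λ a c → x ≡ 2 ^ a * q ^ suc c × n < 2 ^ suc a

  room-mono : ∀ {m n x} → m ≤ n → Room n x → Room m x
  room-mono m≤n (a , c , x≡ , n<) = a , c , x≡ , ≤-<-trans m≤n n<

  room-below : ∀ {n x} → Room n x → Below x (binExp n)
  room-below (a , c , refl , n<2^1+a) =
    desc-below-multiple {a} (<-≤-trans 1<q (m≤m*n q (q ^ c) {{m^n≢0 q c}})) (binExp-bounded n<2^1+a)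

  -- Room for n persists for n + 1 when q ∣ n + 1, as q never divides 2^(a+1).
  room-step : ∀ {n x} → q ∣ n + 1 → Room n x → Room (n + 1) x
  room-step {n} q∣n+1 (a , c , x≡ , n<) with m≤n⇒m<n∨m≡n (subst (_≤ 2 ^ suc a) (+-comm 1 n) n<)
  ... | inj₁ n+1< = a , c , x≡ , n+1<
  ... | inj₂ n+1≡ = ⊥-elim (q∤2^ (suc a) (subst (q ∣_) n+1≡ q∣n+1))

  -- Every binary part divides each q-part 2^a·q^(c+1) (they come later), so
  -- the binary amount leaves room below every q-part.
  binary-room : ∀ {L} → All (Is2qPart q) L → Chained L → All (Room (binAmount L)) (qParts L)
  binary-room {L} ps c = All.zipWith room (qParts-form ps , belows)
    where
    split = shape-split ps c
    belows = proj₂ (proj₂ split)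
    room : ∀ {x} → QPart x × Below x (binParts L) → Room (binAmount L) x
    room ((a , c , refl) , below) = a , c , refl ,
      desc-sum< (powers-desc {suc a} (all-filter binary? L) (proj₁ (proj₂ split))
        (below-odd-multiple {a} {q ^ suc c} (odd-^ {q} q-odd (suc c)) (all-filter binary? L) below))

  replace-binary : ∀ {L n} → All (Is2qPart q) L → Chained L → All (Room n) (qParts L) →
    Chained (qParts L ++ binExp n)
  replace-binary {L} {n} ps c rooms = chained-++
    (proj₁ (shape-split ps c))
    (desc-chained (proj₂ (binExp-desc n)))
    (All.map room-below rooms)

  replace-binary-parts : ∀ {L} n → All (Is2qPart q) L → All (Is2qPart q) (qParts L ++ binExp n)
  replace-binary-parts n ps = ++⁺ (filter⁺ nonBinary? ps) (desc-parts (proj₂ (binExp-desc n)))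

  binParts-expansion : ∀ {L} → All (Is2qPart q) L → Chained L → binExp (binAmount L) ≡ binParts L
  binParts-expansion {L} ps c =
    binExp-unique (proj₂ (powers-desc-∃ (all-filter binary? L) (proj₁ (proj₂ (shape-split ps c)))))

  scale-qParts : ∀ {ys} → All (Is2qPart q) ys → All QPart (map (q *_) ys)
  scale-qParts [] = []
  scale-qParts ((a , b , refl) ∷ ps) = (a , b , x∙yz≈y∙xz q (2 ^ a) (q ^ b)) ∷ scale-qParts ps

  unscale-qParts : ∀ {L} → All QPart L → ∃[ ys ] All (Is2qPart q) ys × L ≡ map (q *_) ys
  unscale-qParts [] = [] , [] , refl
  unscale-qParts ((a , c , refl) ∷ qs) =
    let ys , ps , L≡ = unscale-qParts qs
    in 2 ^ a * q ^ c ∷ ys , (a , c , refl) ∷ ps , cong₂ _∷_ (x∙yz≈y∙xz (2 ^ a) q (q ^ c)) L≡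

  scaled-partition : ∀ {U xs} → InQΩ q U xs → IsSCP q (q * U) xs
  scaled-partition (ys , (ps , c , s) , refl) =
    parts⁺ (All.map qPart-part (scale-qParts (parts⁻ ps))) ,
    chained-scale q ys c ,
    trans (sum-scale q ys) (cong (q *_) s)

  unscaled-partition : ∀ {U xs} → IsSCP q (q * U) xs → binParts xs ≡ [] → InQΩ q U xs
  unscaled-partition {U} {xs} (ps , c , s) no-binary =
    ys , (parts⁺ ys-parts , chained-unscale q ys (subst Chained xs≡ c) , sum-ys) , xs≡
    where
    xs≡qParts : xs ≡ qParts xs
    xs≡qParts = trans (chained-shape (parts⁻ ps) c)
      (trans (cong (qParts xs ++_) no-binary) (++-identityʳ (qParts xs)))
    unscaled = unscale-qParts (subst (All QPart) (sym xs≡qParts) (qParts-form (parts⁻ ps)))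
    ys = proj₁ unscaled
    ys-parts = proj₁ (proj₂ unscaled)
    xs≡ = proj₂ (proj₂ unscaled)
    sum-ys : sum ys ≡ U
    sum-ys = *-cancelˡ-≡ (sum ys) U q (trans (sym (sum-scale q ys)) (trans (cong sum (sym xs≡)) s))

  lower-binary : ∀ {W xs n} → IsSCP q W xs → binAmount xs ≡ suc n → In1ΩPred q W xs
  lower-binary {W} {xs} {n} (ps′ , c , s) B≡1+n =
    sum ys , ys , total , (parts⁺ (replace-binary-parts n ps) , replace-binary ps c rooms , refl) , restore
    where
    open ≡-Reasoning
    ps = parts⁻ ps′
    ys = qParts xs ++ binExp n
    rooms : All (Room n) (qParts xs)
    rooms = All.map (room-mono (subst (n ≤_) (sym B≡1+n) (n≤1+n n))) (binary-room ps c)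
    total : suc (sum ys) ≡ W
    total = begin
      suc (sum ys)                     ≡⟨ cong suc (incBin-sum xs n) ⟩
      suc (sum (qParts xs) + n)        ≡⟨ sym (+-suc (sum (qParts xs)) n) ⟩
      sum (qParts xs) + suc n          ≡⟨ cong (sum (qParts xs) +_) (sym B≡1+n) ⟩
      sum (qParts xs) + binAmount xs   ≡⟨ sym (sum-shape ps c) ⟩
      sum xs                           ≡⟨ s ⟩
      W                                ∎
    binAmount-ys : binAmount ys ≡ n
    binAmount-ys = trans (cong sum (incBin-binParts xs n)) (binExp-sum n)
    restore : xs ≡ incBin ys
    restore = begin
      xs                                      ≡⟨ chained-shape ps c ⟩
      qParts xs ++ binParts xs                ≡⟨ cong (qParts xs ++_) (sym (binParts-expansion ps c)) ⟩
      qParts xs ++ binExp (binAmount xs)      ≡⟨ cong (λ m → qParts xs ++ binExp m) (trans B≡1+n (+-comm 1 n)) ⟩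
      qParts xs ++ binExp (n + 1)             ≡⟨ cong₂ (λ A m → A ++ binExp (m + 1)) (sym (incBin-qParts xs n))
                                                        (sym binAmount-ys) ⟩
      qParts ys ++ binExp (binAmount ys + 1)  ∎

  raise-binary : ∀ {W xs} → q ∣ W → In1ΩPred q W xs → IsSCP q W xs
  raise-binary {W} q∣W (V , ys , 1+V≡W , (ps′ , c , s) , refl) =
    parts⁺ (replace-binary-parts (b + 1) ps) , replace-binary ps c rooms ,
    trans (incBin-sum ys (b + 1)) total
    where
    open ≡-Reasoning
    ps = parts⁻ ps′
    b = binAmount ys
    total : sum (qParts ys) + (b + 1) ≡ W
    total = begin
      sum (qParts ys) + (b + 1)   ≡⟨ sym (+-assoc (sum (qParts ys)) b 1) ⟩
      sum (qParts ys) + b + 1     ≡⟨ cong (_+ 1) (trans (sym (sum-shape ps c)) s) ⟩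
      V + 1                       ≡⟨ +-comm V 1 ⟩
      suc V                       ≡⟨ 1+V≡W ⟩
      W                           ∎
    q∣b+1 : q ∣ b + 1
    q∣b+1 = ∣m+n∣m⇒∣n (subst (q ∣_) (sym total) q∣W) (q∣sum (qParts-form ps))
    rooms : All (Room (b + 1)) (qParts ys)
    rooms = All.map (room-step q∣b+1) (binary-room ps c)

  -- Scaled partitions have no binary part; incBin always produces one.
  disjoint : ∀ {U W xs} → InQΩ q U xs → In1ΩPred q W xs → ⊥
  disjoint (ys , (ps , _ , _) , refl) (_ , ys′ , _ , _ , xs≡) =
    1+n≢0 (trans (+-comm 1 b) (trans (sym (binExp-sum (b + 1))) (cong sum no-binary)))
    where
    b = binAmount ys′
    no-binary : binExp (b + 1) ≡ []
    no-binary = begin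
      binExp (b + 1)                            ≡⟨ sym (incBin-binParts ys′ (b + 1)) ⟩
      binParts (incBin ys′)                     ≡⟨ cong binParts (sym xs≡) ⟩
      binParts (map (q *_) ys)                  ≡⟨ proj₂ (all-nonBinary (All.map (not-T ∘ qPart-nonBinary)
                                                     (scale-qParts (parts⁻ ps)))) ⟩
      []                                        ∎
      where open ≡-Reasoning

  decompose : ∀ {U xs} → IsSCP q (q * U) xs → InQΩ q U xs ⊎ In1ΩPred q (q * U) xs
  decompose {xs = xs} p@(ps , c , _) with binAmount xs in B≡
  ... | zero = inj₁ (unscaled-partition p (trans (sym (binParts-expansion (parts⁻ ps) c)) (cong binExp B≡)))
  ... | suc n = inj₂ (lower-binary p B≡)

proposition2p3 : (q : ℕ) → 1 < q → q % 2 ≡ 1 → (U : ℕ) → (xs : List ℕ) →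
    (IsSCP q (q * U) xs ⇔ (InQΩ q U xs ⊎ In1ΩPred q (q * U) xs))
      × (InQΩ q U xs → In1ΩPred q (q * U) xs → ⊥)
proposition2p3 q 1<q q-odd U xs =
  mk⇔ decompose [ scaled-partition , raise-binary (m∣m*n U) ] , disjoint
  where open OddBase q 1<q q-odd
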